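{- If the 2-sequent $\vdash A^{s}$ is provable in $2_{\mathsf{LTL}}$, then so is $\vdash A^{s\oplus t}$, for every position $t$.
   Context: Temporal formulas are built from proposition symbols using $\neg,\wedge,\vee,\to$ and the unary operators $\Box,\Diamond,\bigcirc$ (always, sometime, next). Positions are pairs $\langle n,S\rangle$ with $n\in\mathbb N$ and $S$ a finite set of tokens from a countably infinite set. For $s=\langle n,S\rangle$, $t=\langle m,T\rangle$: $s\oplus t=\langle n+m,S\cup T\rangle$; $s\oplus m$ means $s\oplus\langle m,\varnothing\rangle$; $s\oplus x$ means $s\oplus\langle 0,\{x\}\rangle$. A p-formula is $A^s$; a 2-sequent is $\Gamma\vdash\Delta$ with $\Gamma,\Delta$ finite sequences of p-formulas; $x\notin s,\Gamma,\Delta$ means the token $x$ belongs to no position in $s,\Gamma,\Delta$. The calculus $2_{\mathsf{LTL}}$: Axiom $A^s\vdash A^s$; unrestricted Cut; weakening, contraction, exchange; classical propositional sequent rules for $\neg,\wedge,\vee,\to$ with all active p-formulas at the same position; temporal rules: from $\Gamma,A^{s\oplus t}\vdash\Delta$ infer $\Gamma,(\Box A)^s\vdash\Delta$ ($t$ any position); from $\Gamma\vdash A^{s\oplus x},\Delta$ infer $\Gamma\vdash(\Box A)^s,\Delta$; from $\Gamma,A^{s\oplus x}\vdash\Delta$ infer $\Gamma,(\Diamond A)^s\vdash\Delta$; from $\Gamma\vdash A^{s\oplus t},\Delta$ infer $\Gamma\vdash(\Diamond A)^s,\Delta$; from $\Gamma,A^{s\oplus 1}\vdash\Delta$ infer $\Gamma,(\bigcirc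 A)^s\vdash\Delta$; from $\Gamma\vdash A^{s\oplus1},\Delta$ infer $\Gamma\vdash(\bigcirc A)^s,\Delta$; IND: from $\Gamma,A^{s\oplus x}\vdash A^{s\oplus x\oplus 1},\Delta$ infer $\Gamma,A^s\vdash A^{s\oplus t},\Delta$. In the right $\Box$ rule, the left $\Diamond$ rule and IND, $x\notin s,\Gamma,\Delta$. -}

module Defs where

open import Data.Nat using (ℕ; _+_)
open import Data.List using (List; []; _∷_; _++_; _∷ʳ_)
open import Data.List.Membership.Propositional using (_∈_; _∉_)
open import Data.List.Relation.Unary.All using (All)
open import Data.Product using (_×_)
open import Relation.Binary.PropositionalEquality using (_≡_)

PropSym : Set
PropSym = ℕ

Token : Set
Token = ℕ

infixr 4 _⇒_
infixr 5 _∨′_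
infixr 6 _∧′_

data Fml : Set where
  atom : PropSym → Fml
  ¬′_  : Fml → Fml
  _∧′_ : Fml → Fml → Fml
  _∨′_ : Fml → Fml → Fml
  _⇒_  : Fml → Fml → Fml
  □_   : Fml → Fml
  ◇_   : Fml → Fml
  ○_   : Fml → Fml

-- A position ⟨ n , S ⟩ ; the finite token set S is represented by a list,
-- read up to set equality (see _≈ₚ_ and the axiom rule below).
record Pos : Set where
  constructor ⟨_,_⟩
  field
    num  : ℕ
    toks : List Token
open Pos public

infixl 6 _⊕_ _⊕ₙ_ _⊕ₓ_

_⊕_ : Pos → Pos → Pos
s ⊕ t = ⟨ num s + num t , toks s ++ toks t ⟩

_⊕ₙ_ : Pos → ℕ → Pos
s ⊕ₙ m = s ⊕ ⟨ m , [] ⟩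

_⊕ₓ_ : Pos → Token → Pos
s ⊕ₓ x = s ⊕ ⟨ 0 , x ∷ [] ⟩

_≈ₚ_ : Pos → Pos → Set
s ≈ₚ t = (num s ≡ num t) × (∀ y → (y ∈ toks s → y ∈ toks t) × (y ∈ toks t → y ∈ toks s))

infix 8 _^_
record PFml : Set where
  constructor _^_
  field
    fml : Fml
    pos : Pos
open PFml public

Seq : Set
Seq = List PFml

_∉ₚ_ : Token → Pos → Set
x ∉ₚ s = x ∉ toks s

_∉ₛ_ : Token → Seq → Set
x ∉ₛ Γ = All (λ p → x ∉ₚ pos p) Γ

infix 2 _⊢_

-- The calculus 2_LTL.  Left principal formulas are written at the right end
-- of the antecedent, right principal formulas at the left end of the succedent.
data _⊢_ : Seq → Seq → Set where
  ax   : ∀ {A s s'} → s ≈ₚ s' → (A ^ s ∷ []) ⊢ (A ^ s' ∷ [])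
  cut  : ∀ {Γ Δ Σ Π p} → Γ ⊢ p ∷ Δ → Σ ∷ʳ p ⊢ Π → Γ ++ Σ ⊢ Δ ++ Π
  wL   : ∀ {Γ Δ p} → Γ ⊢ Δ → Γ ∷ʳ p ⊢ Δ
  wR   : ∀ {Γ Δ p} → Γ ⊢ Δ → Γ ⊢ p ∷ Δ
  cL   : ∀ {Γ Δ p} → Γ ∷ʳ p ∷ʳ p ⊢ Δ → Γ ∷ʳ p ⊢ Δ
  cR   : ∀ {Γ Δ p} → Γ ⊢ p ∷ p ∷ Δ → Γ ⊢ p ∷ Δ
  xL   : ∀ {Γ Γ' Δ p q} → Γ ++ p ∷ q ∷ Γ' ⊢ Δ → Γ ++ q ∷ p ∷ Γ' ⊢ Δ
  xR   : ∀ {Γ Δ Δ' p q} → Γ ⊢ Δ ++ p ∷ q ∷ Δ' → Γ ⊢ Δ ++ q ∷ p ∷ Δ'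
  ¬L   : ∀ {Γ Δ A s} → Γ ⊢ A ^ s ∷ Δ → Γ ∷ʳ (¬′ A) ^ s ⊢ Δ
  ¬R   : ∀ {Γ Δ A s} → Γ ∷ʳ A ^ s ⊢ Δ → Γ ⊢ (¬′ A) ^ s ∷ Δ
  ∧L₁  : ∀ {Γ Δ A B s} → Γ ∷ʳ A ^ s ⊢ Δ → Γ ∷ʳ (A ∧′ B) ^ s ⊢ Δ
  ∧L₂  : ∀ {Γ Δ A B s} → Γ ∷ʳ B ^ s ⊢ Δ → Γ ∷ʳ (A ∧′ B) ^ s ⊢ Δ
  ∧R   : ∀ {Γ Δ A B s} → Γ ⊢ A ^ s ∷ Δ → Γ ⊢ B ^ s ∷ Δ → Γ ⊢ (A ∧′ B) ^ s ∷ Δ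
  ∨L   : ∀ {Γ Δ A B s} → Γ ∷ʳ A ^ s ⊢ Δ → Γ ∷ʳ B ^ s ⊢ Δ → Γ ∷ʳ (A ∨′ B) ^ s ⊢ Δ
  ∨R₁  : ∀ {Γ Δ A B s} → Γ ⊢ A ^ s ∷ Δ → Γ ⊢ (A ∨′ B) ^ s ∷ Δ
  ∨R₂  : ∀ {Γ Δ A B s} → Γ ⊢ B ^ s ∷ Δ → Γ ⊢ (A ∨′ B) ^ s ∷ Δ
  ⇒L   : ∀ {Γ Δ Σ Π A B s} → Γ ⊢ A ^ s ∷ Δ → Σ ∷ʳ B ^ s ⊢ Π →
         (Γ ++ Σ) ∷ʳ (A ⇒ B) ^ s ⊢ Δ ++ Π
  ⇒R   : ∀ {Γ Δ A B s} → Γ ∷ʳ A ^ s ⊢ B ^ s ∷ Δ → Γ ⊢ (A ⇒ B) ^ s ∷ Δ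
  □L   : ∀ {Γ Δ A s} (t : Pos) → Γ ∷ʳ A ^ (s ⊕ t) ⊢ Δ → Γ ∷ʳ (□ A) ^ s ⊢ Δ
  □R   : ∀ {Γ Δ A s} (x : Token) → x ∉ₚ s → x ∉ₛ Γ → x ∉ₛ Δ →
         Γ ⊢ A ^ (s ⊕ₓ x) ∷ Δ → Γ ⊢ (□ A) ^ s ∷ Δ
  ◇L   : ∀ {Γ Δ A s} (x : Token) → x ∉ₚ s → x ∉ₛ Γ → x ∉ₛ Δ →
         Γ ∷ʳ A ^ (s ⊕ₓ x) ⊢ Δ → Γ ∷ʳ (◇ A) ^ s ⊢ Δ
  ◇R   : ∀ {Γ Δ A s} (t : Pos) → Γ ⊢ A ^ (s ⊕ t) ∷ Δ → Γ ⊢ (◇ A) ^ s ∷ Δ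
  ○L   : ∀ {Γ Δ A s} → Γ ∷ʳ A ^ (s ⊕ₙ 1) ⊢ Δ → Γ ∷ʳ (○ A) ^ s ⊢ Δ
  ○R   : ∀ {Γ Δ A s} → Γ ⊢ A ^ (s ⊕ₙ 1) ∷ Δ → Γ ⊢ (○ A) ^ s ∷ Δ
  ind  : ∀ {Γ Δ A s} (t : Pos) (x : Token) → x ∉ₚ s → x ∉ₛ Γ → x ∉ₛ Δ →
         Γ ∷ʳ A ^ (s ⊕ₓ x) ⊢ A ^ (s ⊕ₓ x ⊕ₙ 1) ∷ Δ →
         Γ ∷ʳ A ^ s ⊢ A ^ (s ⊕ t) ∷ Δ

-- The natural idea is to add t to every position of a derivation.  This
-- commutes with every rule except that an eigenvariable x of a □R, ◇L or
-- IND inference may occur in t, and would no longer be fresh.  So we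
-- translate positions by  s ↦ ρ(s) ⊕ t , where ρ is a renaming of tokens
-- that is refined, at each eigenvariable inference, to send x to a token y
-- fresh for the translated sequent.  Positions of the translated sequent
-- are only required to be equivalent (as sets of tokens) to these images,
-- which absorbs the reordering of tokens caused by the translation.

module Submission where

open import Defs
open import Algebra.Bundles using (CommutativeMonoid)
open import Data.Nat using (suc; _+_; _≟_)
open import Data.Nat.Properties using (<-irrefl; +-commutativeSemigroup)
open import Data.List using (List; []; _∷_; _++_; _∷ʳ_; [_]; map)
open import Data.List.Properties using (map-++; map-id; ++-assoc; ++-identityʳ)
open import Data.List.Extrema.Nat using (max; xs≤max)
open import Data.List.Membership.Propositional using (_∈_; _∉_)
open import Data.List.Membership.Propositional.Properties using (∈-++⁺ˡ; ∈-++⁺ʳ)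
open import Data.List.Relation.Unary.All as All using (All; []; _∷_)
open import Data.List.Relation.Unary.Any using (here; there)
open import Data.List.Relation.Binary.Subset.Propositional using (_⊆_)
import Data.List.Relation.Binary.Subset.Propositional.Properties as ⊆
open import Data.List.Relation.Binary.Permutation.Propositional using (_↭_; ↭-sym; ↭-trans; ↭-reflexive)
open import Data.List.Relation.Binary.Permutation.Propositional.Properties using (∈-resp-↭; ++-commutativeMonoid)
open import Data.List.Relation.Binary.Pointwise using (Pointwise; []; _∷_; ++⁺)
open import Data.Product using (Σ; ∃₂; _×_; _,_; proj₁; proj₂)
open import Function using (id)
open import Relation.Nullary using (¬_; yes; no; contradiction)
open import Relation.Binary.PropositionalEquality using (_≡_; refl; sym; trans; cong; cong₂; subst)
open import Algebra.Properties.CommutativeSemigroup +-commutativeSemigroup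
  using () renaming (xy∙z≈xz∙y to +-swapʳ)
open import Algebra.Properties.CommutativeSemigroup
  (CommutativeMonoid.commutativeSemigroup (++-commutativeMonoid {A = Token}))
  using () renaming (xy∙z≈xz∙y to ++-swapʳ)

private
  variable
    Γ Δ Λ Π : Seq
    p : PFml
    A B : Fml
    s s′ u v w : Pos
    xs ys zs : List Token

_≋_ : List Token → List Token → Set
xs ≋ ys = ∀ y → (y ∈ xs → y ∈ ys) × (y ∈ ys → y ∈ xs)

⊆-antisym : xs ⊆ ys → ys ⊆ xs → xs ≋ ys
⊆-antisym xs⊆ys ys⊆xs y = xs⊆ys , ys⊆xs

≋⇒⊆ : xs ≋ ys → xs ⊆ ys
≋⇒⊆ eq {y} = proj₁ (eq y)

≋⇒⊇ : xs ≋ ys → ys ⊆ xs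
≋⇒⊇ eq {y} = proj₂ (eq y)

↭⇒≋ : xs ↭ ys → xs ≋ ys
↭⇒≋ π = ⊆-antisym (∈-resp-↭ π) (∈-resp-↭ (↭-sym π))

≋-++ʳ : ∀ zs → xs ≋ ys → (xs ++ zs) ≋ (ys ++ zs)
≋-++ʳ zs eq = ⊆-antisym (⊆.++⁺ˡ zs (≋⇒⊆ eq)) (⊆.++⁺ˡ zs (≋⇒⊇ eq))

≋-map : ∀ (ρ : Token → Token) → xs ≋ ys → map ρ xs ≋ map ρ ys
≋-map ρ eq = ⊆-antisym (⊆.map⁺ ρ (≋⇒⊆ eq)) (⊆.map⁺ ρ (≋⇒⊇ eq))

≈ₚ-reflexive : s ≡ s′ → s ≈ₚ s′
≈ₚ-reflexive refl = refl , λ y → id , id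

≈ₚ-sym : s ≈ₚ s′ → s′ ≈ₚ s
≈ₚ-sym (n≡ , eq) = sym n≡ , λ y → proj₂ (eq y) , proj₁ (eq y)

≈ₚ-trans : u ≈ₚ v → v ≈ₚ w → u ≈ₚ w
≈ₚ-trans (n≡ , eq) (n≡′ , eq′) =
  trans n≡ n≡′ , λ y → (λ m → proj₁ (eq′ y) (proj₁ (eq y) m))
                     , (λ m → proj₂ (eq y) (proj₂ (eq′ y) m))

⊕-congˡ : u ≈ₚ v → (u ⊕ w) ≈ₚ (v ⊕ w)
⊕-congˡ {w = w} (n≡ , eq) = cong (_+ num w) n≡ , ≋-++ʳ (toks w) eq

Renaming : Set
Renaming = Token → Token

_[_↦_] : Renaming → Token → Token → Renaming
(ρ [ x ↦ y ]) z with z ≟ x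
... | yes _ = y
... | no  _ = ρ z

update-here : ∀ ρ x y → (ρ [ x ↦ y ]) x ≡ y
update-here ρ x y with x ≟ x
... | yes _  = refl
... | no x≢x = contradiction refl x≢x

update-there : ∀ ρ x y {z} → ¬ z ≡ x → (ρ [ x ↦ y ]) z ≡ ρ z
update-there ρ x y {z} z≢x with z ≟ x
... | yes z≡x = contradiction z≡x z≢x
... | no  _   = refl

map-update-∉ : ∀ ρ x y zs → x ∉ zs → map (ρ [ x ↦ y ]) zs ≡ map ρ zs
map-update-∉ ρ x y []       x∉ = refl
map-update-∉ ρ x y (z ∷ zs) x∉ =
  cong₂ _∷_ (update-there ρ x y (λ z≡x → x∉ (here (sym z≡x))))
            (map-update-∉ ρ x y zs (λ x∈ → x∉ (there x∈)))

fresh : List Token → Token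
fresh zs = suc (max 0 zs)

fresh-∉ : ∀ zs → fresh zs ∉ zs
fresh-∉ zs fresh∈ = <-irrefl refl (All.lookup (xs≤max 0 zs) fresh∈)

tokensOf : Seq → List Token
tokensOf []      = []
tokensOf (p ∷ Γ) = toks (pos p) ++ tokensOf Γ

∉-tokensOf : ∀ {x} Γ → x ∉ tokensOf Γ → x ∉ₛ Γ
∉-tokensOf []      x∉ = []
∉-tokensOf (p ∷ Γ) x∉ =
  (λ x∈ → x∉ (∈-++⁺ˡ x∈)) ∷ ∉-tokensOf Γ (λ x∈ → x∉ (∈-++⁺ʳ (toks (pos p)) x∈))

freshFor : (u : Pos) (Γ Δ : Seq) → Σ Token λ y → y ∉ₚ u × y ∉ₛ Γ × y ∉ₛ Δ
freshFor u Γ Δ =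
  y , (λ y∈ → y∉ (∈-++⁺ˡ y∈))
    , ∉-tokensOf Γ (λ y∈ → y∉ (∈-++⁺ʳ (toks u) (∈-++⁺ˡ y∈)))
    , ∉-tokensOf Δ (λ y∈ → y∉ (∈-++⁺ʳ (toks u) (∈-++⁺ʳ (tokensOf Γ) y∈)))
  where
  all = toks u ++ tokensOf Γ ++ tokensOf Δ
  y = fresh all
  y∉ = fresh-∉ all

toFront : ∀ Ω Δ → Γ ⊢ Ω ++ Δ ++ p ∷ Π → Γ ⊢ Ω ++ p ∷ Δ ++ Π
toFront Ω []      d = d
toFront {Γ} {p} {Π} Ω (q ∷ Δ) d =
  xR {Δ = Ω} (subst (Γ ⊢_) (++-assoc Ω [ q ] (p ∷ Δ ++ Π))
    (toFront (Ω ∷ʳ q) Δ (subst (Γ ⊢_) (sym (++-assoc Ω [ q ] (Δ ++ p ∷ Π))) d)))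

-- Cutting against the axiom A^s ⊢ A^s′ moves A to an equivalent position.
resp-≈ₚ : Γ ⊢ A ^ s ∷ Δ → s ≈ₚ s′ → Γ ⊢ A ^ s′ ∷ Δ
resp-≈ₚ {Γ} {A} {s} {Δ} {s′} d s≈s′ =
  subst (λ Ω → Γ ⊢ A ^ s′ ∷ Ω) (++-identityʳ Δ)
    (toFront [] Δ (subst (_⊢ Δ ++ [ A ^ s′ ]) (++-identityʳ Γ)
      (cut {Σ = []} d (ax s≈s′))))

-- A list pointwise related to a concatenation (or a snoc) splits accordingly;
-- this locates the images of the side formulas of a translated rule.
module _ {R : PFml → PFml → Set} where

  ++⁻ : ∀ Γ {Θ} → Pointwise R (Γ ++ Λ) Θ →
        ∃₂ λ Θ₁ Θ₂ → Θ ≡ Θ₁ ++ Θ₂ × Pointwise R Γ Θ₁ × Pointwise R Λ Θ₂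
  ++⁻ []      rs       = [] , _ , refl , [] , rs
  ++⁻ (p ∷ Γ) (r ∷ rs) with ++⁻ Γ rs
  ... | Θ₁ , Θ₂ , refl , rs₁ , rs₂ = _ ∷ Θ₁ , Θ₂ , refl , r ∷ rs₁ , rs₂

  ∷ʳ⁻ : ∀ Γ {Θ} → Pointwise R (Γ ∷ʳ p) Θ →
        Σ Seq λ Θ₀ → Σ PFml λ q → Θ ≡ Θ₀ ∷ʳ q × Pointwise R Γ Θ₀ × R p q
  ∷ʳ⁻ Γ rs with ++⁻ Γ rs
  ... | Θ₀ , q ∷ [] , refl , rs₀ , r ∷ [] = Θ₀ , q , refl , rs₀ , r

module Translation (t : Pos) where

  ren : Renaming → Pos → Pos
  ren ρ s = ⟨ num s , map ρ (toks s) ⟩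

  φ : Renaming → Pos → Pos
  φ ρ s = ren ρ s ⊕ t

  φ-id : ∀ s → (s ⊕ t) ≈ₚ φ id s
  φ-id s = ≈ₚ-reflexive (cong (λ zs → ⟨ num s + num t , zs ++ toks t ⟩) (sym (map-id (toks s))))

  φ-cong : ∀ ρ → s ≈ₚ s′ → φ ρ s ≈ₚ φ ρ s′
  φ-cong ρ (n≡ , eq) = ⊕-congˡ (n≡ , ≋-map ρ eq)

  -- The image of s ⊕ t₀ is the image of s plus the renamed t₀: this is why
  -- □L, ◇R and ○ commute with the translation.
  φ-⊕ : ∀ ρ s t₀ → (φ ρ s ⊕ ren ρ t₀) ≈ₚ φ ρ (s ⊕ t₀)
  φ-⊕ ρ s t₀ =
    +-swapʳ (num s) (num t) (num t₀) ,
    ↭⇒≋ (↭-trans (++-swapʳ (map ρ (toks s)) (toks t) (map ρ (toks t₀)))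
                 (↭-reflexive (cong (_++ toks t) (sym (map-++ ρ (toks s) (toks t₀))))))

  φ-update-∉ : ∀ ρ {x} y → x ∉ toks s → u ≈ₚ φ ρ s → u ≈ₚ φ (ρ [ x ↦ y ]) s
  φ-update-∉ {s} {u} ρ {x} y x∉ =
    subst (λ zs → u ≈ₚ ⟨ num s + num t , zs ++ toks t ⟩) (sym (map-update-∉ ρ x y (toks s) x∉))

  data Image (ρ : Renaming) : PFml → PFml → Set where
    image : u ≈ₚ φ ρ s → Image ρ (A ^ s) (A ^ u)

  Images : Renaming → Seq → Seq → Set
  Images ρ = Pointwise (Image ρ)

  canonical : ∀ ρ p → Image ρ p (fml p ^ φ ρ (pos p))
  canonical ρ (A ^ s) = image (≈ₚ-reflexive refl)

  image-⊕ : ∀ ρ t₀ → u ≈ₚ φ ρ s → (u ⊕ ren ρ t₀) ≈ₚ φ ρ (s ⊕ t₀)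
  image-⊕ ρ t₀ u≈ = ≈ₚ-trans (⊕-congˡ u≈) (φ-⊕ ρ _ t₀)

  images-update : ∀ {ρ x y Θ} → x ∉ₛ Γ → Images ρ Γ Θ → Images (ρ [ x ↦ y ]) Γ Θ
  images-update []           []                = []
  images-update {ρ = ρ} {y = y} (x∉ ∷ x∉s) (image u≈ ∷ rs) =
    image (φ-update-∉ ρ y x∉ u≈) ∷ images-update x∉s rs

  image-eigen : ∀ ρ {x} y → x ∉ₚ s → u ≈ₚ φ ρ s → (u ⊕ₓ y) ≈ₚ φ (ρ [ x ↦ y ]) (s ⊕ₓ x)
  image-eigen {s = s} {u = u} ρ {x} y x∉ u≈ =
    subst (λ z → (u ⊕ₓ z) ≈ₚ φ (ρ [ x ↦ y ]) (s ⊕ₓ x)) (update-here ρ x y)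
      (image-⊕ (ρ [ x ↦ y ]) ⟨ 0 , [ x ] ⟩ (φ-update-∉ ρ y x∉ u≈))

  Translatable : Seq → Seq → Set
  Translatable Γ Δ = ∀ {ρ Γ′ Δ′} → Images ρ Γ Γ′ → Images ρ Δ Δ′ → Γ′ ⊢ Δ′

  ax-tr : s ≈ₚ s′ → Translatable [ A ^ s ] [ A ^ s′ ]
  ax-tr s≈s′ {ρ} (image u≈ ∷ []) (image v≈ ∷ []) =
    ax (≈ₚ-trans u≈ (≈ₚ-trans (φ-cong ρ s≈s′) (≈ₚ-sym v≈)))

  -- The cut formula is translated to its canonical image.
  cut-tr : ∀ Γ Δ → Translatable Γ (p ∷ Δ) → Translatable (Λ ∷ʳ p) Π →
           Translatable (Γ ++ Λ) (Δ ++ Π)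
  cut-tr {p = p} Γ Δ d₁ d₂ {ρ} gs hs with ++⁻ Γ gs | ++⁻ Δ hs
  ... | _ , _ , refl , gs₁ , gs₂ | _ , _ , refl , hs₁ , hs₂ =
    cut (d₁ gs₁ (canonical ρ p ∷ hs₁)) (d₂ (++⁺ gs₂ (canonical ρ p ∷ [])) hs₂)

  wL-tr : ∀ Γ → Translatable Γ Δ → Translatable (Γ ∷ʳ p) Δ
  wL-tr Γ d gs hs with ∷ʳ⁻ Γ gs
  ... | _ , _ , refl , gs₀ , _ = wL (d gs₀ hs)

  cL-tr : ∀ Γ → Translatable (Γ ∷ʳ p ∷ʳ p) Δ → Translatable (Γ ∷ʳ p) Δ
  cL-tr Γ d gs hs with ∷ʳ⁻ Γ gs
  ... | _ , _ , refl , gs₀ , r = cL (d (++⁺ (++⁺ gs₀ (r ∷ [])) (r ∷ [])) hs)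

  xL-tr : ∀ Γ {Γ₁ q} → Translatable (Γ ++ p ∷ q ∷ Γ₁) Δ → Translatable (Γ ++ q ∷ p ∷ Γ₁) Δ
  xL-tr Γ d gs hs with ++⁻ Γ gs
  ... | Θ , _ ∷ _ ∷ _ , refl , gs₁ , rq ∷ rp ∷ gs₂ = xL {Γ = Θ} (d (++⁺ gs₁ (rp ∷ rq ∷ gs₂)) hs)

  xR-tr : ∀ Δ {Δ₁ q} → Translatable Γ (Δ ++ p ∷ q ∷ Δ₁) → Translatable Γ (Δ ++ q ∷ p ∷ Δ₁)
  xR-tr Δ d gs hs with ++⁻ Δ hs
  ... | Θ , _ ∷ _ ∷ _ , refl , hs₁ , rq ∷ rp ∷ hs₂ = xR {Δ = Θ} (d gs (++⁺ hs₁ (rp ∷ rq ∷ hs₂)))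

  ¬L-tr : ∀ Γ → Translatable Γ (A ^ s ∷ Δ) → Translatable (Γ ∷ʳ (¬′ A) ^ s) Δ
  ¬L-tr Γ d gs hs with ∷ʳ⁻ Γ gs
  ... | _ , _ , refl , gs₀ , image u≈ = ¬L (d gs₀ (image u≈ ∷ hs))

  ∧L₁-tr : ∀ Γ → Translatable (Γ ∷ʳ A ^ s) Δ → Translatable (Γ ∷ʳ (A ∧′ B) ^ s) Δ
  ∧L₁-tr Γ d gs hs with ∷ʳ⁻ Γ gs
  ... | _ , _ , refl , gs₀ , image u≈ = ∧L₁ (d (++⁺ gs₀ (image u≈ ∷ [])) hs)

  ∧L₂-tr : ∀ Γ → Translatable (Γ ∷ʳ B ^ s) Δ → Translatable (Γ ∷ʳ (A ∧′ B) ^ s) Δ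
  ∧L₂-tr Γ d gs hs with ∷ʳ⁻ Γ gs
  ... | _ , _ , refl , gs₀ , image u≈ = ∧L₂ (d (++⁺ gs₀ (image u≈ ∷ [])) hs)

  ∨L-tr : ∀ Γ → Translatable (Γ ∷ʳ A ^ s) Δ → Translatable (Γ ∷ʳ B ^ s) Δ →
          Translatable (Γ ∷ʳ (A ∨′ B) ^ s) Δ
  ∨L-tr Γ d₁ d₂ gs hs with ∷ʳ⁻ Γ gs
  ... | _ , _ , refl , gs₀ , image u≈ =
    ∨L (d₁ (++⁺ gs₀ (image u≈ ∷ [])) hs) (d₂ (++⁺ gs₀ (image u≈ ∷ [])) hs)

  ⇒L-tr : ∀ Γ Δ → Translatable Γ (A ^ s ∷ Δ) → Translatable (Λ ∷ʳ B ^ s) Π →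
          Translatable ((Γ ++ Λ) ∷ʳ (A ⇒ B) ^ s) (Δ ++ Π)
  ⇒L-tr {Λ = Λ} Γ Δ d₁ d₂ gs hs with ∷ʳ⁻ (Γ ++ Λ) gs
  ... | _ , _ , refl , gs₀ , image u≈ with ++⁻ Γ gs₀ | ++⁻ Δ hs
  ...   | _ , _ , refl , gs₁ , gs₂ | _ , _ , refl , hs₁ , hs₂ =
    ⇒L (d₁ gs₁ (image u≈ ∷ hs₁)) (d₂ (++⁺ gs₂ (image u≈ ∷ [])) hs₂)

  -- □L instantiates at t₀; its translation instantiates at the renamed t₀.
  □L-tr : ∀ Γ t₀ → Translatable (Γ ∷ʳ A ^ (s ⊕ t₀)) Δ → Translatable (Γ ∷ʳ (□ A) ^ s) Δ
  □L-tr Γ t₀ d {ρ} gs hs with ∷ʳ⁻ Γ gs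
  ... | _ , _ , refl , gs₀ , image u≈ =
    □L (ren ρ t₀) (d (++⁺ gs₀ (image (image-⊕ ρ t₀ u≈) ∷ [])) hs)

  ○L-tr : ∀ Γ → Translatable (Γ ∷ʳ A ^ (s ⊕ₙ 1)) Δ → Translatable (Γ ∷ʳ (○ A) ^ s) Δ
  ○L-tr Γ d {ρ} gs hs with ∷ʳ⁻ Γ gs
  ... | _ , _ , refl , gs₀ , image u≈ =
    ○L (d (++⁺ gs₀ (image (image-⊕ ρ ⟨ 1 , [] ⟩ u≈) ∷ [])) hs)

  -- Eigenvariable rules: the eigenvariable x is redirected to a token y
  -- fresh for the translated conclusion, which then serves as eigenvariable.
  □R-tr : ∀ x → x ∉ₚ s → x ∉ₛ Γ → x ∉ₛ Δ →
          Translatable Γ (A ^ (s ⊕ₓ x) ∷ Δ) → Translatable Γ ((□ A) ^ s ∷ Δ)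
  □R-tr x x∉s x∉Γ x∉Δ d {ρ} {Γ′} {_ ^ u ∷ Δ′} gs (image u≈ ∷ hs) with freshFor u Γ′ Δ′
  ... | y , y∉u , y∉Γ′ , y∉Δ′ =
    □R y y∉u y∉Γ′ y∉Δ′
      (d (images-update x∉Γ gs) (image (image-eigen ρ y x∉s u≈) ∷ images-update x∉Δ hs))

  ◇L-tr : ∀ Γ x → x ∉ₚ s → x ∉ₛ Γ → x ∉ₛ Δ →
          Translatable (Γ ∷ʳ A ^ (s ⊕ₓ x)) Δ → Translatable (Γ ∷ʳ (◇ A) ^ s) Δ
  ◇L-tr Γ x x∉s x∉Γ x∉Δ d {ρ} {Δ′ = Δ′} gs hs with ∷ʳ⁻ Γ gs
  ... | Θ , _ ^ u , refl , gs₀ , image u≈ with freshFor u Θ Δ′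
  ...   | y , y∉u , y∉Θ , y∉Δ′ =
    ◇L y y∉u y∉Θ y∉Δ′
      (d (++⁺ (images-update x∉Γ gs₀) (image (image-eigen ρ y x∉s u≈) ∷ []))
         (images-update x∉Δ hs))

  -- IND concludes A^u ⊢ A^(u ⊕ ren ρ t₀), which the derived rule resp-≈ₚ
  -- moves to the prescribed image of A^(s ⊕ t₀).
  ind-tr : ∀ Γ t₀ x → x ∉ₚ s → x ∉ₛ Γ → x ∉ₛ Δ →
           Translatable (Γ ∷ʳ A ^ (s ⊕ₓ x)) (A ^ (s ⊕ₓ x ⊕ₙ 1) ∷ Δ) →
           Translatable (Γ ∷ʳ A ^ s) (A ^ (s ⊕ t₀) ∷ Δ)
  ind-tr {s = s} Γ t₀ x x∉s x∉Γ x∉Δ d {ρ} {Δ′ = _ ∷ Δ′} gs (image v≈ ∷ hs) with ∷ʳ⁻ Γ gs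
  ... | Θ , _ ^ u , refl , gs₀ , image u≈ with freshFor u Θ Δ′
  ...   | y , y∉u , y∉Θ , y∉Δ′ =
    resp-≈ₚ (ind (ren ρ t₀) y y∉u y∉Θ y∉Δ′
               (d (++⁺ (images-update x∉Γ gs₀) (image eigen ∷ []))
                  (image (image-⊕ (ρ [ x ↦ y ]) ⟨ 1 , [] ⟩ eigen) ∷ images-update x∉Δ hs)))
            (≈ₚ-trans (image-⊕ ρ t₀ u≈) (≈ₚ-sym v≈))
    where
    eigen : (u ⊕ₓ y) ≈ₚ φ (ρ [ x ↦ y ]) (s ⊕ₓ x)
    eigen = image-eigen ρ y x∉s u≈

  translate : Γ ⊢ Δ → Translatable Γ Δ
  translate (ax s≈s′)                      gs hs = ax-tr s≈s′ gs hs
  translate (cut {Γ} {Δ} d₁ d₂)            gs hs = cut-tr Γ Δ (translate d₁) (translate d₂) gs hs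
  translate (wL {Γ} d)                     gs hs = wL-tr Γ (translate d) gs hs
  translate (wR d)                         gs (_ ∷ hs) = wR (translate d gs hs)
  translate (cL {Γ} d)                     gs hs = cL-tr Γ (translate d) gs hs
  translate (cR d)                         gs (r ∷ hs) = cR (translate d gs (r ∷ r ∷ hs))
  translate (xL {Γ} d)                     gs hs = xL-tr Γ (translate d) gs hs
  translate (xR {Δ = Δ} d)                 gs hs = xR-tr Δ (translate d) gs hs
  translate (¬L {Γ} d)                     gs hs = ¬L-tr Γ (translate d) gs hs
  translate (¬R d)                         gs (image u≈ ∷ hs) =
    ¬R (translate d (++⁺ gs (image u≈ ∷ [])) hs)
  translate (∧L₁ {Γ} d)                    gs hs = ∧L₁-tr Γ (translate d) gs hs
  translate (∧L₂ {Γ} d)                    gs hs = ∧L₂-tr Γ (translate d) gs hs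
  translate (∧R d₁ d₂)                     gs (image u≈ ∷ hs) =
    ∧R (translate d₁ gs (image u≈ ∷ hs)) (translate d₂ gs (image u≈ ∷ hs))
  translate (∨L {Γ} d₁ d₂)                 gs hs = ∨L-tr Γ (translate d₁) (translate d₂) gs hs
  translate (∨R₁ d)                        gs (image u≈ ∷ hs) = ∨R₁ (translate d gs (image u≈ ∷ hs))
  translate (∨R₂ d)                        gs (image u≈ ∷ hs) = ∨R₂ (translate d gs (image u≈ ∷ hs))
  translate (⇒L {Γ} {Δ} d₁ d₂)             gs hs = ⇒L-tr Γ Δ (translate d₁) (translate d₂) gs hs
  translate (⇒R d)                         gs (image u≈ ∷ hs) =
    ⇒R (translate d (++⁺ gs (image u≈ ∷ [])) (image u≈ ∷ hs))
  translate (□L {Γ} t₀ d)                  gs hs = □L-tr Γ t₀ (translate d) gs hs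
  translate (□R x x∉s x∉Γ x∉Δ d)           gs hs = □R-tr x x∉s x∉Γ x∉Δ (translate d) gs hs
  translate (◇L {Γ} x x∉s x∉Γ x∉Δ d)       gs hs = ◇L-tr Γ x x∉s x∉Γ x∉Δ (translate d) gs hs
  translate (◇R t₀ d) {ρ}                  gs (image u≈ ∷ hs) =
    ◇R (ren ρ t₀) (translate d gs (image (image-⊕ ρ t₀ u≈) ∷ hs))
  translate (○L {Γ} d)                     gs hs = ○L-tr Γ (translate d) gs hs
  translate (○R d) {ρ}                     gs (image u≈ ∷ hs) =
    ○R (translate d gs (image (image-⊕ ρ ⟨ 1 , [] ⟩ u≈) ∷ hs))
  translate (ind {Γ} t₀ x x∉s x∉Γ x∉Δ d)   gs hs = ind-tr Γ t₀ x x∉s x∉Γ x∉Δ (translate d) gs hs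

mainTheorem14 : (A : Fml) (s t : Pos) → [] ⊢ (A ^ s ∷ []) → [] ⊢ (A ^ (s ⊕ t) ∷ [])
mainTheorem14 A s t d = translate d [] (image (φ-id s) ∷ [])
  where open Translation t
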